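{- Let $n\ge 3$ and $1\le a,r\le n-1$ be integers with $r^2\equiv -1\pmod n$ and $ra\equiv \pm a\pmod n$. Then the rose window graph $R_n(a,r)$ is a Cayley graph.
   Context: For integers $n\ge 3$ and $1\le a,r\le n-1$, the rose window graph $R_n(a,r)$ has vertex set $\{A_i,B_i : i\in\mathbb{Z}_n\}$ and edges $A_iA_{i+1}$, $A_iB_i$, $A_{i+a}B_i$ and $B_iB_{i+r}$, indices taken modulo $n$. A graph is Cayley iff its automorphism group has a subgroup acting regularly on its vertices. -}

module Defs where

open import Data.Nat using (ℕ; zero; suc)
import Data.Nat as ℕ
open import Data.Nat.DivMod using (_mod_)
open import Data.Fin using (Fin; toℕ)
open import Data.Integer using (ℤ; +_; _-_)
open import Data.Integer.Divisibility using (_∣_)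
open import Data.Product using (Σ; _×_; _,_)
open import Data.Sum using (_⊎_)
open import Data.Empty using (⊥)
open import Function.Bundles using (_↔_; _⇔_; Inverse)
open import Relation.Binary.PropositionalEquality using (_≡_)
open import Level using (Level) renaming (suc to lsuc; zero to lzero)

_≡_[mod_] : ℤ → ℤ → ℕ → Set
x ≡ y [mod n ] = (+ n) ∣ (x - y)

_⊕_ : ∀ {n} → Fin n → ℕ → Fin n
_⊕_ {suc m} i k = (toℕ i ℕ.+ k) mod (suc m)

data Vertex (n : ℕ) : Set where
  A : Fin n → Vertex n
  B : Fin n → Vertex n

-- directed "generating" edges of R_n(a,r):
-- A_i A_{i+1},  A_i B_i,  A_{i+a} B_i,  B_i B_{i+r}
Edge : (n a r : ℕ) → Vertex n → Vertex n → Set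
Edge n a r (A i) (A j) = j ≡ i ⊕ 1
Edge n a r (A j) (B i) = (j ≡ i) ⊎ (j ≡ i ⊕ a)
Edge n a r (B i) (A j) = ⊥
Edge n a r (B i) (B j) = j ≡ i ⊕ r

Adj : (n a r : ℕ) → Vertex n → Vertex n → Set
Adj n a r u v = Edge n a r u v ⊎ Edge n a r v u

record Aut (n a r : ℕ) : Set where
  field
    perm     : Vertex n ↔ Vertex n
  open Inverse perm public
  field
    preserve : ∀ u v → Adj n a r u v ⇔ Adj n a r (to u) (to v)

open Aut

-- a subgroup of Aut(R_n(a,r)) (given as a predicate on automorphisms,
-- automorphisms compared extensionally by their action) acting regularly
-- on the vertex set
record RegularSubgroup (n a r : ℕ) : Set₁ where
  field
    member       : Aut n a r → Set
    member-resp  : ∀ g h → (∀ v → to g v ≡ to h v) → member g → member h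
    has-id       : Σ (Aut n a r) λ e → member e × (∀ v → to e v ≡ v)
    has-comp     : ∀ g h → member g → member h →
                   Σ (Aut n a r) λ k → member k × (∀ v → to k v ≡ to g (to h v))
    has-inv      : ∀ g → member g →
                   Σ (Aut n a r) λ k → member k × (∀ v → to k v ≡ from g v)
    transitive   : ∀ u v → Σ (Aut n a r) λ g → member g × (to g u ≡ v)
    semiregular  : ∀ g h → member g → member h → ∀ u →
                   to g u ≡ to h u → ∀ v → to g v ≡ to h v

-- R_n(a,r) is a Cayley graph iff Aut has a subgroup acting regularly
IsCayleyRoseWindow : (n a r : ℕ) → Set₁
IsCayleyRoseWindow n a r = RegularSubgroup n a r

{-# OPTIONS --safe #-}
-- The hypotheses force n = 2a, because 2a = (r² + 1)a − (r ± 1)(ra ∓ a) is divisible by n and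
-- 0 < 2a < 2n; then r² ≡ −1 (mod 2a) makes r and a odd.  Write a vertex as a side s ∈ ℤ₂
-- (A = 0, B = 1) and an index x ∈ ℤₙ.  The maps (s , x) ↦ (s + j , rʲx + c + a·j·s) are
-- automorphisms (they are generated by the rotation x ↦ x + 1 and by A_i ↦ B_{ri}, B_i ↦ A_{ri+a}),
-- they compose like (j , c)(j' , c') = (j + j' , rʲc' + c + a·j·j'), and since r² ≡ −1 only j mod 4
-- and c mod n matter: a group of order 4n acting transitively on the 2n vertices.  The stabiliser
-- of a vertex has order 2 (the reflection j = 2, x ↦ 2x₀ − x), and it meets the index-2 subgroup
-- c ≡ (j choose 2) (mod 2) trivially, so that subgroup acts regularly.
module Submission where

open import Defs
open import Data.Nat as ℕ using (ℕ; zero; suc; NonZero; _≤_; _<_; _∸_; s≤s; z≤n)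
import Data.Nat.Properties as ℕ
import Data.Nat.Divisibility as ℕ
open import Data.Nat.DivMod using (m≡m%n+[m/n]*n; m%n<n)
import Data.Nat.Tactic.RingSolver as ℕ-Solver
open import Data.Fin using (Fin; toℕ; fromℕ<)
open import Data.Fin.Properties using (toℕ-fromℕ<; toℕ-injective; toℕ<n)
open import Data.Integer as ℤ using (ℤ; +_; -_; 0ℤ; 1ℤ)
open import Data.Integer.Properties using (pos-*)
open import Data.Empty using (⊥-elim)
open import Data.Product using (∃; _,_; _×_)
open import Data.Sum as Sum using (_⊎_; inj₁; inj₂)
open import Function.Base using (_∘′_)
open import Function.Bundles using (mk↔ₛ′; mk⇔)
open import Relation.Nullary using (¬_; contradiction)
open import Relation.Binary.Bundles using (Setoid)
import Relation.Binary.Reasoning.Setoid as SetoidReasoning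
open import Relation.Binary.PropositionalEquality

module _ {n a r : ℕ} where

  AdjacencyPreserving : (Vertex n → Vertex n) → Set
  AdjacencyPreserving f = ∀ u v → Adj n a r u v → Adj n a r (f u) (f v)

  automorphism : (f g : Vertex n → Vertex n) →
                 (∀ v → f (g v) ≡ v) → (∀ v → g (f v) ≡ v) →
                 AdjacencyPreserving f → AdjacencyPreserving g → Aut n a r
  automorphism f g fg gf f-adj g-adj = record
    { perm     = mk↔ₛ′ f g fg gf
    ; preserve = λ u v → mk⇔ (f-adj u v)
                   (λ adj → subst₂ (Adj n a r) (gf u) (gf v) (g-adj (f u) (f v) adj))
    }

  edge-preserving : ∀ {f} → (∀ u v → Edge n a r u v → Adj n a r (f u) (f v)) →
                    AdjacencyPreserving f
  edge-preserving f-edge u v = Sum.[ f-edge u v , Sum.swap ∘′ f-edge v u ]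

  ∘-preserving : ∀ {f g} → AdjacencyPreserving f → AdjacencyPreserving g →
                 AdjacencyPreserving (f ∘′ g)
  ∘-preserving f-adj g-adj u v = f-adj _ _ ∘′ g-adj u v

  ≗-preserving : ∀ {f g} → (∀ v → f v ≡ g v) → AdjacencyPreserving f → AdjacencyPreserving g
  ≗-preserving f≗g f-adj u v adj = subst₂ (Adj n a r) (f≗g u) (f≗g v) (f-adj u v adj)

record RegularAction (n a r : ℕ) : Set₁ where
  field
    Element       : Set
    act           : Element → Vertex n → Vertex n
    act-preserves : ∀ γ → AdjacencyPreserving {n} {a} {r} (act γ)
    unit          : Element
    _·_           : Element → Element → Element
    inv           : Element → Element
    unit-act      : ∀ v → act unit v ≡ v
    ·-act         : ∀ γ δ v → act (γ · δ) v ≡ act γ (act δ v)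
    inv-act       : ∀ γ v → act (inv γ) (act γ v) ≡ v
    base          : Vertex n
    reach         : ∀ v → ∃ λ γ → act γ base ≡ v
    free          : ∀ γ u → act γ u ≡ u → ∀ v → act γ v ≡ v

module _ {n a r : ℕ} (G : RegularAction n a r) where
  open RegularAction G

  -- inv-act applied to inv γ shows that inv (inv γ) and γ act alike, so inverses are two-sided.
  act-inv : ∀ γ v → act γ (act (inv γ) v) ≡ v
  act-inv γ v = begin
    act γ (act (inv γ) v)
      ≡⟨ inv-act (inv γ) _ ⟨
    act (inv (inv γ)) (act (inv γ) (act γ (act (inv γ) v)))
      ≡⟨ cong (act (inv (inv γ))) (inv-act γ _) ⟩
    act (inv (inv γ)) (act (inv γ) v)
      ≡⟨ inv-act (inv γ) v ⟩
    v ∎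
    where open ≡-Reasoning

  aut : Element → Aut n a r
  aut γ = automorphism (act γ) (act (inv γ)) (act-inv γ) (inv-act γ)
                       (act-preserves γ) (act-preserves (inv γ))

  regularSubgroup : RegularSubgroup n a r
  regularSubgroup = record
    { member      = Member
    ; member-resp = λ { g h g≗h (γ , g≗γ) → γ , λ v → trans (sym (g≗h v)) (g≗γ v) }
    ; has-id      = aut unit , (unit , λ _ → refl) , unit-act
    ; has-comp    = λ { g h (γ , g≗γ) (δ , h≗δ) → aut (γ · δ) , (γ · δ , λ _ → refl) ,
                      λ v → trans (·-act γ δ v) (sym (trans (g≗γ _) (cong (act γ) (h≗δ v)))) }
    ; has-inv     = λ { g (γ , g≗γ) → aut (inv γ) , (inv γ , λ _ → refl) , λ v →
                      trans (cong (act (inv γ)) (trans (sym (Aut.strictlyInverseˡ g v)) (g≗γ _)))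
                            (inv-act γ _) }
    ; transitive  = transitive
    ; semiregular = semiregular
    }
    where
    Member : Aut n a r → Set
    Member g = ∃ λ γ → ∀ v → Aut.to g v ≡ act γ v

    transitive : ∀ u v → ∃ λ g → Member g × (Aut.to g u ≡ v)
    transitive u v with reach u | reach v
    ... | γ , γ-base | δ , δ-base = aut (δ · inv γ) , (δ · inv γ , λ _ → refl) , (begin
      act (δ · inv γ) u                 ≡⟨ ·-act δ (inv γ) u ⟩
      act δ (act (inv γ) u)             ≡⟨ cong (act δ ∘′ act (inv γ)) γ-base ⟨
      act δ (act (inv γ) (act γ base))  ≡⟨ cong (act δ) (inv-act γ base) ⟩
      act δ base                        ≡⟨ δ-base ⟩
      v                                 ∎)
      where open ≡-Reasoning

    semiregular : ∀ g h → Member g → Member h → ∀ u → Aut.to g u ≡ Aut.to h u →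
                  ∀ v → Aut.to g v ≡ Aut.to h v
    semiregular g h (γ , g≗γ) (δ , h≗δ) u gu≡hu v = begin
      Aut.to g v                     ≡⟨ g≗γ v ⟩
      act γ v                        ≡⟨ act-inv δ (act γ v) ⟨
      act δ (act (inv δ) (act γ v))  ≡⟨ cong (act δ) (·-act (inv δ) γ v) ⟨
      act δ (act (inv δ · γ) v)      ≡⟨ cong (act δ) (free (inv δ · γ) u fixes v) ⟩
      act δ v                        ≡⟨ h≗δ v ⟨
      Aut.to h v                     ∎
      where
      open ≡-Reasoning
      fixes : act (inv δ · γ) u ≡ u
      fixes = trans (·-act (inv δ) γ u)
        (trans (cong (act (inv δ)) (trans (sym (g≗γ u)) (trans gu≡hu (h≗δ u)))) (inv-act δ u))

-- Integer arithmetic is opened only in this block: its _*_ would clash with the ℕ one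
-- in the statement of mainTheorem4.
module _ where
  open import Data.Integer using (_+_; _*_; _-_; _^_; _%ℕ_; _/ℕ_; _⊖_; ∣_∣)
  open import Data.Integer.Properties
    using ( pos-+; +-identityˡ; +-identityʳ; +-inverseʳ; *-comm; *-assoc; *-identityˡ; *-identityʳ
          ; -1*i≡-i; neg-involutive; ^-zeroˡ; ^-distribˡ-+-*
          ; m-n≡m⊖n; ∣⊖∣-≤; ∣m⊖n∣≡∣n⊖m∣ )
  open import Data.Integer.DivMod using (n%ℕd<d; a≡a%ℕn+[a/ℕn]*n)
  import Data.Integer.Divisibility.Signed as Signed
  open import Data.Integer.Tactic.RingSolver using (solve-∀)

  -- _≡_[mod_] unfolds to divisibility of x - y, from which unification cannot recover x and y;
  -- the record keeps them visible.
  infix 4 _≈_[mod_]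
  record _≈_[mod_] (x y : ℤ) (d : ℕ) : Set where
    constructor congruent
    field divides : x ≡ y [mod d ]

  module _ {d : ℕ} where

    private
      from-signed : ∀ {x y z} → z ≡ x - y → + d Signed.∣ z → x ≈ y [mod d ]
      from-signed refl p = congruent (Signed.∣⇒∣ᵤ p)

      to-signed : ∀ {x y} → x ≈ y [mod d ] → + d Signed.∣ x - y
      to-signed (congruent p) = Signed.∣ᵤ⇒∣ p

    mod-intro : ∀ {x y} k → x ≡ y + k * + d → x ≈ y [mod d ]
    mod-intro {y = y} k refl = from-signed (identity y k (+ d)) (Signed.divides k refl)
      where identity : ∀ y k d → k * d ≡ y + k * d - y
            identity = solve-∀

    mod-elim : ∀ {x y} → x ≈ y [mod d ] → ∃ λ k → x ≡ y + k * + d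
    mod-elim {x} {y} p with to-signed p
    ... | Signed.divides k eq = k , trans (identity x y) (cong (λ z → y + z) eq)
      where identity : ∀ x y → x ≡ y + (x - y)
            identity = solve-∀

    mod-refl : ∀ {x} → x ≈ x [mod d ]
    mod-refl {x} = mod-intro 0ℤ (identity x (+ d))
      where identity : ∀ x d → x ≡ x + 0ℤ * d
            identity = solve-∀

    ≡⇒mod : ∀ {x y} → x ≡ y → x ≈ y [mod d ]
    ≡⇒mod refl = mod-refl

    mod-sym : ∀ {x y} → x ≈ y [mod d ] → y ≈ x [mod d ]
    mod-sym {x} {y} p = from-signed (identity x y) (Signed.∣m⇒∣-m (to-signed p))
      where identity : ∀ x y → - (x - y) ≡ y - x
            identity = solve-∀

    mod-trans : ∀ {x y z} → x ≈ y [mod d ] → y ≈ z [mod d ] → x ≈ z [mod d ]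
    mod-trans {x} {y} {z} p q =
      from-signed (identity x y z) (Signed.∣m∣n⇒∣m+n (to-signed p) (to-signed q))
      where identity : ∀ x y z → (x - y) + (y - z) ≡ x - z
            identity = solve-∀

    +-cong-mod : ∀ {x y u v} → x ≈ y [mod d ] → u ≈ v [mod d ] → x + u ≈ y + v [mod d ]
    +-cong-mod {x} {y} {u} {v} p q =
      from-signed (identity x y u v) (Signed.∣m∣n⇒∣m+n (to-signed p) (to-signed q))
      where identity : ∀ x y u v → (x - y) + (u - v) ≡ x + u - (y + v)
            identity = solve-∀

    *-cong-mod : ∀ {x y u v} → x ≈ y [mod d ] → u ≈ v [mod d ] → x * u ≈ y * v [mod d ]
    *-cong-mod {x} {y} {u} {v} p q = from-signed (identity x y u v)
      (Signed.∣m∣n⇒∣m+n (Signed.∣m⇒∣m*n u (to-signed p)) (Signed.∣n⇒∣m*n y (to-signed q)))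
      where identity : ∀ x y u v → (x - y) * u + y * (u - v) ≡ x * u - y * v
            identity = solve-∀

    -‿cong-mod : ∀ {x y} → x ≈ y [mod d ] → - x ≈ - y [mod d ]
    -‿cong-mod {x} {y} p = from-signed (identity x y) (Signed.∣m⇒∣-m (to-signed p))
      where identity : ∀ x y → - (x - y) ≡ - x - - y
            identity = solve-∀

    +-congˡ-mod : ∀ z {x y} → x ≈ y [mod d ] → z + x ≈ z + y [mod d ]
    +-congˡ-mod z = +-cong-mod (mod-refl {z})

    +-congʳ-mod : ∀ z {x y} → x ≈ y [mod d ] → x + z ≈ y + z [mod d ]
    +-congʳ-mod z p = +-cong-mod p (mod-refl {z})

    *-congˡ-mod : ∀ z {x y} → x ≈ y [mod d ] → z * x ≈ z * y [mod d ]
    *-congˡ-mod z = *-cong-mod (mod-refl {z})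

    *-congʳ-mod : ∀ z {x y} → x ≈ y [mod d ] → x * z ≈ y * z [mod d ]
    *-congʳ-mod z p = *-cong-mod p (mod-refl {z})

    ^-cong-mod : ∀ {x y} → x ≈ y [mod d ] → ∀ j → x ^ j ≈ y ^ j [mod d ]
    ^-cong-mod p zero    = mod-refl
    ^-cong-mod p (suc j) = *-cong-mod p (^-cong-mod p j)

    mod-flip : ∀ {x y} k → y ≈ x + k [mod d ] → x ≈ y + - k [mod d ]
    mod-flip {x} {y} k p = mod-trans (≡⇒mod (identity x k)) (+-congʳ-mod (- k) (mod-sym p))
      where identity : ∀ x k → x ≡ x + k + - k
            identity = solve-∀

  mod-setoid : ℕ → Setoid _ _
  mod-setoid d = record
    { Carrier       = ℤ
    ; _≈_           = _≈_[mod d ]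
    ; isEquivalence = record { refl = mod-refl ; sym = mod-sym ; trans = mod-trans }
    }

  module mod-Reasoning (d : ℕ) = SetoidReasoning (mod-setoid d)

  module _ {d : ℕ} where

    private
      divisible-below⇒0 : ∀ {m} → m < d → d ℕ.∣ m → m ≡ 0
      divisible-below⇒0 {zero}  _   _   = refl
      divisible-below⇒0 {suc m} m<d d∣m = ⊥-elim (ℕ.>⇒∤ m<d d∣m)

      ordered-injective : ∀ {u v} → u ≤ v → v < d → d ℕ.∣ ∣ u ⊖ v ∣ → u ≡ v
      ordered-injective {u} {v} u≤v v<d d∣ = ℕ.≤-antisym u≤v (ℕ.m∸n≡0⇒m≤n
        (divisible-below⇒0 (ℕ.≤-<-trans (ℕ.m∸n≤m v u) v<d)
                           (subst (d ℕ.∣_) (∣⊖∣-≤ u≤v) d∣)))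

    mod-injective-below : ∀ {u v} → u < d → v < d → + u ≈ + v [mod d ] → u ≡ v
    mod-injective-below {u} {v} u<d v<d (congruent d∣) with ℕ.≤-total u v
    ... | inj₁ u≤v = ordered-injective u≤v v<d (subst (λ z → d ℕ.∣ ∣ z ∣) (m-n≡m⊖n u v) d∣)
    ... | inj₂ v≤u = sym (ordered-injective v≤u u<d
      (subst (d ℕ.∣_) (trans (cong ∣_∣ (m-n≡m⊖n u v)) (∣m⊖n∣≡∣n⊖m∣ u v)) d∣))

    module _ .{{_ : NonZero d}} where

      %ℕ-mod : ∀ x → + (x %ℕ d) ≈ x [mod d ]
      %ℕ-mod x = mod-sym (mod-intro (x /ℕ d) (a≡a%ℕn+[a/ℕn]*n x d))

      %ℕ-cong : ∀ {x y} → x ≈ y [mod d ] → x %ℕ d ≡ y %ℕ d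
      %ℕ-cong {x} {y} p = mod-injective-below (n%ℕd<d x d) (n%ℕd<d y d)
        (mod-trans (%ℕ-mod x) (mod-trans p (mod-sym (%ℕ-mod y))))

  mod-divisor : ∀ {d e x y} → + d ≈ 0ℤ [mod e ] → x ≈ y [mod d ] → x ≈ y [mod e ]
  mod-divisor {d} {e} {x} {y} d≈0 x≈y with mod-elim d≈0 | mod-elim x≈y
  ... | s , d≡se | t , x≡y+td = mod-intro (t * s) (begin
    x                     ≡⟨ x≡y+td ⟩
    y + t * + d           ≡⟨ cong (λ z → y + t * z) d≡se ⟩
    y + t * (0ℤ + s * + e) ≡⟨ identity y t s (+ e) ⟩
    y + t * s * + e       ∎)
    where
    open ≡-Reasoning
    identity : ∀ y t s e → y + t * (0ℤ + s * e) ≡ y + t * s * e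
    identity = solve-∀

  *-scale-mod : ∀ {d x y} k → x ≈ y [mod d ] → + k * x ≈ + k * y [mod k ℕ.* d ]
  *-scale-mod {d} {x} {y} k x≈y with mod-elim x≈y
  ... | t , x≡y+td = mod-intro t (begin
    + k * x                 ≡⟨ cong (+ k *_) x≡y+td ⟩
    + k * (y + t * + d)     ≡⟨ identity (+ k) y t (+ d) ⟩
    + k * y + t * (+ k * + d) ≡⟨ cong (λ z → + k * y + t * z) (pos-* k d) ⟨
    + k * y + t * + (k ℕ.* d) ∎)
    where
    open ≡-Reasoning
    identity : ∀ k y t d → k * (y + t * d) ≡ k * y + t * (k * d)
    identity = solve-∀

  double≈0 : ∀ m → + (m ℕ.* 2) ≈ 0ℤ [mod 2 ]
  double≈0 m = mod-intro (+ m) (trans (pos-* m 2) (sym (+-identityˡ (+ m * + 2))))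

  parity : ∀ x → x ≈ 0ℤ [mod 2 ] ⊎ x ≈ 1ℤ [mod 2 ]
  parity x with x %ℕ 2 | n%ℕd<d x 2 | %ℕ-mod {2} x
  ... | 0           | _            | p = inj₁ (mod-sym p)
  ... | 1           | _            | p = inj₂ (mod-sym p)
  ... | suc (suc _) | s≤s (s≤s ()) | _

  1≉0 : ¬ 1ℤ ≈ 0ℤ [mod 2 ]
  1≉0 p = contradiction (mod-injective-below {2} {1} {0} (ℕ.s<s ℕ.z<s) ℕ.z<s p) λ ()

  square≈-1⇒odd : ∀ x → x * x ≈ - 1ℤ [mod 2 ] → x ≈ 1ℤ [mod 2 ]
  square≈-1⇒odd x x²≈-1 with parity x
  ... | inj₂ x≈1 = x≈1
  ... | inj₁ x≈0 = contradiction (mod-trans (mod-sym (mod-trans x²≈-1 (mod-intro (- 1ℤ) refl)))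
                                            (*-cong-mod x≈0 x≈0)) 1≉0

  odd-square : ∀ {x} → x ≈ 1ℤ [mod 2 ] → x * x ≈ 1ℤ [mod 4 ]
  odd-square x≈1 with mod-elim x≈1
  ... | k , refl = mod-intro (k * k + k) (identity k)
    where identity : ∀ k → (1ℤ + k * + 2) * (1ℤ + k * + 2) ≡ 1ℤ + (k * k + k) * + 4
          identity = solve-∀

  square≈-1⇒half-modulus-odd : ∀ {m} x → x * x ≈ - 1ℤ [mod m ℕ.* 2 ] → + m ≈ 1ℤ [mod 2 ]
  square≈-1⇒half-modulus-odd {m} x x²≈-1 with parity (+ m)
  ... | inj₂ m≈1 = m≈1
  ... | inj₁ m≈0 =
    contradiction (mod-injective-below {4} {1} {3} (ℕ.s<s ℕ.z<s) (ℕ.s<s (ℕ.s<s (ℕ.s<s ℕ.z<s))) 1≈3)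
                  λ ()
    where
    2m≈0 : + (m ℕ.* 2) ≈ 0ℤ [mod 4 ]
    2m≈0 = mod-trans (≡⇒mod (trans (pos-* m 2) (*-comm (+ m) (+ 2)))) (*-scale-mod 2 m≈0)
    x-odd : x ≈ 1ℤ [mod 2 ]
    x-odd = square≈-1⇒odd x (mod-divisor (double≈0 m) x²≈-1)
    1≈3 : 1ℤ ≈ + 3 [mod 4 ]
    1≈3 = mod-trans (mod-sym (odd-square x-odd))
                    (mod-trans (mod-divisor 2m≈0 x²≈-1) (mod-intro (- 1ℤ) refl))

  divisible-double : ∀ {m n} → 0 < m → m < n → n ℕ.∣ m ℕ.* 2 → n ≡ m ℕ.* 2
  divisible-double {suc m} _ _ (ℕ.divides zero ())
  divisible-double {m} {n} _ _ (ℕ.divides 1 eq) = sym (trans eq (ℕ.+-identityʳ n))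
  divisible-double {m} {n} _ m<n (ℕ.divides (suc (suc q)) eq) = contradiction eq (ℕ.<⇒≢ (begin-strict
    m ℕ.* 2            <⟨ ℕ.*-monoˡ-< 2 m<n ⟩
    n ℕ.* 2            ≡⟨ ℕ.*-comm n 2 ⟩
    2 ℕ.* n            ≤⟨ ℕ.*-monoˡ-≤ n {2} {suc (suc q)} (s≤s (s≤s z≤n)) ⟩
    suc (suc q) ℕ.* n  ∎))
    where open ℕ.≤-Reasoning

  modulus-is-double : ∀ {n a r} → 0 < a → a < n → + r * + r ≈ - 1ℤ [mod n ] →
                      + r * + a ≈ + a [mod n ] ⊎ + r * + a ≈ - + a [mod n ] → n ≡ a ℕ.* 2
  modulus-is-double {n} {a} {r} 0<a a<n r²≈-1 ra≈±a =
    divisible-double 0<a a<n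
      (subst (n ℕ.∣_) (ℕ.+-identityʳ (a ℕ.* 2)) (_≈_[mod_].divides (2a≈0 ra≈±a)))
    where
    R M : ℤ
    R = + r
    M = + a
    open mod-Reasoning n

    2a≈0 : R * M ≈ M [mod n ] ⊎ R * M ≈ - M [mod n ] → + (a ℕ.* 2) ≈ 0ℤ [mod n ]
    2a≈0 (inj₁ ra≈a) = begin
      + (a ℕ.* 2)                               ≡⟨ pos-* a 2 ⟩
      M * + 2                                   ≡⟨ identity R M ⟩
      (R * R + 1ℤ) * M - (R + 1ℤ) * (R * M - M)
        ≈⟨ +-cong-mod (*-congʳ-mod M (+-congʳ-mod 1ℤ r²≈-1))
                      (-‿cong-mod (*-congˡ-mod (R + 1ℤ) (+-congʳ-mod (- M) ra≈a))) ⟩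
      (- 1ℤ + 1ℤ) * M - (R + 1ℤ) * (M - M)      ≡⟨ vanish R M ⟩
      0ℤ                                        ∎
      where
      identity : ∀ R M → M * + 2 ≡ (R * R + 1ℤ) * M - (R + 1ℤ) * (R * M - M)
      identity = solve-∀
      vanish : ∀ R M → (- 1ℤ + 1ℤ) * M - (R + 1ℤ) * (M - M) ≡ 0ℤ
      vanish = solve-∀
    2a≈0 (inj₂ ra≈-a) = begin
      + (a ℕ.* 2)                               ≡⟨ pos-* a 2 ⟩
      M * + 2                                   ≡⟨ identity R M ⟩
      (R * R + 1ℤ) * M - (R - 1ℤ) * (R * M + M)
        ≈⟨ +-cong-mod (*-congʳ-mod M (+-congʳ-mod 1ℤ r²≈-1))
                      (-‿cong-mod (*-congˡ-mod (R - 1ℤ) (+-congʳ-mod M ra≈-a))) ⟩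
      (- 1ℤ + 1ℤ) * M - (R - 1ℤ) * (- M + M)    ≡⟨ vanish R M ⟩
      0ℤ                                        ∎
      where
      identity : ∀ R M → M * + 2 ≡ (R * R + 1ℤ) * M - (R - 1ℤ) * (R * M + M)
      identity = solve-∀
      vanish : ∀ R M → (- 1ℤ + 1ℤ) * M - (R - 1ℤ) * (- M + M) ≡ 0ℤ
      vanish = solve-∀

  toℤ : ∀ {n} → Fin n → ℤ
  toℤ i = + toℕ i

  fromℤ : ∀ {n} .{{_ : NonZero n}} → ℤ → Fin n
  fromℤ {n} x = fromℕ< (n%ℕd<d x n)

  module _ {n : ℕ} .{{_ : NonZero n}} where

    toℤ-fromℤ : ∀ x → toℤ (fromℤ {n} x) ≈ x [mod n ]
    toℤ-fromℤ x = mod-trans (≡⇒mod (cong +_ (toℕ-fromℕ< (n%ℕd<d x n)))) (%ℕ-mod x)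

    toℤ-injective-mod : ∀ {i j : Fin n} → toℤ i ≈ toℤ j [mod n ] → i ≡ j
    toℤ-injective-mod {i} {j} p = toℕ-injective (mod-injective-below (toℕ<n i) (toℕ<n j) p)

    fromℤ-cong : ∀ {x y} → x ≈ y [mod n ] → fromℤ {n} x ≡ fromℤ y
    fromℤ-cong {x} {y} p =
      toℤ-injective-mod (mod-trans (toℤ-fromℤ x) (mod-trans p (mod-sym (toℤ-fromℤ y))))

    fromℤ-toℤ : ∀ (i : Fin n) → fromℤ (toℤ i) ≡ i
    fromℤ-toℤ i = toℤ-injective-mod (toℤ-fromℤ (toℤ i))

  toℤ-⊕ : ∀ {n} .{{_ : NonZero n}} (i : Fin n) k → toℤ (i ⊕ k) ≈ toℤ i + + k [mod n ]
  toℤ-⊕ {suc m} i k = mod-trans (≡⇒mod (cong +_ (toℕ-fromℕ< (m%n<n (toℕ i ℕ.+ k) (suc m)))))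
    (mod-trans (%ℕ-mod (+ (toℕ i ℕ.+ k))) (≡⇒mod (pos-+ (toℕ i) k)))

  module _ {n : ℕ} .{{_ : NonZero n}} where

    ⊕⇒mod : ∀ {i j : Fin n} k → j ≡ i ⊕ k → toℤ j ≈ toℤ i + + k [mod n ]
    ⊕⇒mod {i} k refl = toℤ-⊕ i k

    ≡⇒mod+0 : ∀ {i j : Fin n} → j ≡ i → toℤ j ≈ toℤ i + 0ℤ [mod n ]
    ≡⇒mod+0 {i} refl = ≡⇒mod (sym (+-identityʳ (toℤ i)))

    fromℤ-⊕ : ∀ {x y} k → y ≈ x + + k [mod n ] → fromℤ {n} y ≡ fromℤ x ⊕ k
    fromℤ-⊕ {x} {y} k p = toℤ-injective-mod (mod-trans (toℤ-fromℤ y)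
      (mod-trans p (mod-sym (mod-trans (toℤ-⊕ (fromℤ x) k) (+-congʳ-mod (+ k) (toℤ-fromℤ x))))))

    side : Vertex n → ℤ
    side (A _) = 0ℤ
    side (B _) = 1ℤ

    index : Vertex n → ℤ
    index (A i) = toℤ i
    index (B i) = toℤ i

    onSide : ℕ → Fin n → Vertex n
    onSide zero    = A
    onSide (suc _) = B

    -- Opaque, so that unification does not unfold vertex into the residue computations.
    opaque
      vertex : ℤ → ℤ → Vertex n
      vertex s x = onSide (s %ℕ 2) (fromℤ x)

      side-vertex : ∀ s x → side (vertex s x) ≈ s [mod 2 ]
      side-vertex s x with s %ℕ 2 | n%ℕd<d s 2 | %ℕ-mod {2} s
      ... | 0           | _                 | s≈0 = s≈0
      ... | 1           | _                 | s≈1 = s≈1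
      ... | suc (suc _) | s≤s (s≤s ())      | _

      index-vertex : ∀ s x → index (vertex s x) ≈ x [mod n ]
      index-vertex s x with s %ℕ 2
      ... | zero  = toℤ-fromℤ x
      ... | suc _ = toℤ-fromℤ x

      vertex-cong : ∀ {s s' x x'} → s ≈ s' [mod 2 ] → x ≈ x' [mod n ] → vertex s x ≡ vertex s' x'
      vertex-cong p q = cong₂ onSide (%ℕ-cong p) (fromℤ-cong q)

      vertex-side-index : ∀ v → vertex (side v) (index v) ≡ v
      vertex-side-index (A i) = cong A (fromℤ-toℤ i)
      vertex-side-index (B i) = cong B (fromℤ-toℤ i)

      vertex-A : ∀ {s} x → s ≈ 0ℤ [mod 2 ] → vertex s x ≡ A (fromℤ x)
      vertex-A x s≈0 = cong (λ k → onSide k (fromℤ x)) (%ℕ-cong s≈0)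

      vertex-B : ∀ {s} x → s ≈ 1ℤ [mod 2 ] → vertex s x ≡ B (fromℤ x)
      vertex-B x s≈1 = cong (λ k → onSide k (fromℤ x)) (%ℕ-cong s≈1)

  module _ {n a r : ℕ} .{{_ : NonZero n}} where

    vertex-edge-AA : ∀ {s s' x x'} → s ≈ 0ℤ [mod 2 ] → s' ≈ 0ℤ [mod 2 ] →
                     x' ≈ x + 1ℤ [mod n ] → Edge n a r (vertex s x) (vertex s' x')
    vertex-edge-AA {x = x} {x'} s≈0 s'≈0 step =
      subst₂ (Edge n a r) (sym (vertex-A x s≈0)) (sym (vertex-A x' s'≈0)) (fromℤ-⊕ {x = x} 1 step)

    vertex-edge-AB : ∀ {s s' x x'} → s ≈ 0ℤ [mod 2 ] → s' ≈ 1ℤ [mod 2 ] →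
                     x ≈ x' + 0ℤ [mod n ] ⊎ x ≈ x' + + a [mod n ] →
                     Edge n a r (vertex s x) (vertex s' x')
    vertex-edge-AB {x = x} {x'} s≈0 s'≈1 step =
      subst₂ (Edge n a r) (sym (vertex-A x s≈0)) (sym (vertex-B x' s'≈1))
        (Sum.map (λ p → fromℤ-cong (mod-trans p (≡⇒mod (+-identityʳ x'))))
                 (fromℤ-⊕ {x = x'} a) step)

    vertex-edge-BB : ∀ {s s' x x'} → s ≈ 1ℤ [mod 2 ] → s' ≈ 1ℤ [mod 2 ] →
                     x' ≈ x + + r [mod n ] → Edge n a r (vertex s x) (vertex s' x')
    vertex-edge-BB {x = x} {x'} s≈1 s'≈1 step =
      subst₂ (Edge n a r) (sym (vertex-B x s≈1)) (sym (vertex-B x' s'≈1)) (fromℤ-⊕ {x = x} r step)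

  module RoseWindowCayley (a r : ℕ) .{{_ : NonZero a}} (r²≈-1 : + r * + r ≈ - 1ℤ [mod a ℕ.* 2 ]) where

    n : ℕ
    n = a ℕ.* 2

    instance
      n-nonZero : NonZero n
      n-nonZero = ℕ.m*n≢0 a 2

    R M : ℤ
    R = + r
    M = + a

    r-odd : R ≈ 1ℤ [mod 2 ]
    r-odd = square≈-1⇒odd R (mod-divisor (double≈0 a) r²≈-1)

    a-odd : M ≈ 1ℤ [mod 2 ]
    a-odd = square≈-1⇒half-modulus-odd R r²≈-1

    M*-cong : ∀ {x y} → x ≈ y [mod 2 ] → M * x ≈ M * y [mod n ]
    M*-cong = *-scale-mod a

    R^-odd : ∀ j → R ^ j ≈ 1ℤ [mod 2 ]
    R^-odd j = mod-trans (^-cong-mod r-odd j) (≡⇒mod (^-zeroˡ j))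

    R^*M : ∀ j → R ^ j * M ≈ M [mod n ]
    R^*M j = begin
      R ^ j * M  ≡⟨ *-comm (R ^ j) M ⟩
      M * R ^ j  ≈⟨ M*-cong (R^-odd j) ⟩
      M * 1ℤ     ≡⟨ *-identityʳ M ⟩
      M          ∎
      where open mod-Reasoning n

    two≈0 : + 2 ≈ 0ℤ [mod 2 ]
    two≈0 = mod-intro 1ℤ refl

    four≈0 : + 4 ≈ 0ℤ [mod 2 ]
    four≈0 = mod-intro (+ 2) refl

    -- act 0 c is the rotation by c and act 1 0 is A_i ↦ B_{ri}, B_i ↦ A_{ri+a}; together they
    -- generate all the act j c.
    act : ℕ → ℤ → Vertex n → Vertex n
    act j c v = vertex (side v + + j) (R ^ j * index v + c + M * (+ j * side v))

    side-act : ∀ j c v → side (act j c v) ≈ side v + + j [mod 2 ]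
    side-act j c v = side-vertex _ _

    index-act : ∀ j c v → index (act j c v) ≈ R ^ j * index v + c + M * (+ j * side v) [mod n ]
    index-act j c v = index-vertex _ _

    act-cong : ∀ j {c c'} → c ≈ c' [mod n ] → ∀ v → act j c v ≡ act j c' v
    act-cong j c≈c' v =
      vertex-cong mod-refl (+-congʳ-mod (M * (+ j * side v)) (+-congˡ-mod (R ^ j * index v) c≈c'))

    compose-shift : ℕ → ℕ → ℤ → ℤ → ℤ
    compose-shift j j' c c' = R ^ j * c' + c + M * (+ j * + j')

    act-∘ : ∀ j j' c c' v → act j c (act j' c' v) ≡ act (j ℕ.+ j') (compose-shift j j' c c') v
    act-∘ j j' c c' v = vertex-cong side-eq index-eq
      where
      w : Vertex n
      w = act j' c' v
      s x C : ℤ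
      s = side v
      x = index v
      C = compose-shift j j' c c'

      side-eq : side w + + j ≈ s + + (j ℕ.+ j') [mod 2 ]
      side-eq = begin
        side w + + j        ≈⟨ +-congʳ-mod (+ j) (side-act j' c' v) ⟩
        s + + j' + + j      ≡⟨ identity s (+ j) (+ j') ⟩
        s + (+ j + + j')    ≡⟨ cong (λ J → s + J) (pos-+ j j') ⟨
        s + + (j ℕ.+ j')    ∎
        where
        open mod-Reasoning 2
        identity : ∀ s j j' → s + j' + j ≡ s + (j + j')
        identity = solve-∀

      index-eq : R ^ j * index w + c + M * (+ j * side w) ≈
                 R ^ (j ℕ.+ j') * x + C + M * (+ (j ℕ.+ j') * s) [mod n ]
      index-eq = begin
        R ^ j * index w + c + M * (+ j * side w)
          ≈⟨ +-cong-mod (+-congʳ-mod c (*-congˡ-mod (R ^ j) (index-act j' c' v)))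
                        (M*-cong (*-congˡ-mod (+ j) (side-act j' c' v))) ⟩
        R ^ j * (R ^ j' * x + c' + M * (+ j' * s)) + c + M * (+ j * (s + + j'))
          ≡⟨ expand (R ^ j) (R ^ j') x c c' M (+ j) (+ j') s ⟩
        R ^ j * R ^ j' * x + C + (R ^ j * M * (+ j' * s) + M * (+ j * s))
          ≈⟨ +-congˡ-mod (R ^ j * R ^ j' * x + C)
                         (+-congʳ-mod (M * (+ j * s)) (*-congʳ-mod (+ j' * s) (R^*M j))) ⟩
        R ^ j * R ^ j' * x + C + (M * (+ j' * s) + M * (+ j * s))
          ≡⟨ collect (R ^ j * R ^ j') x C M (+ j) (+ j') s ⟩
        R ^ j * R ^ j' * x + C + M * ((+ j + + j') * s)
          ≡⟨ cong₂ (λ E J → E * x + C + M * (J * s)) (^-distribˡ-+-* R j j') (pos-+ j j') ⟨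
        R ^ (j ℕ.+ j') * x + C + M * (+ (j ℕ.+ j') * s)
          ∎
        where
        open mod-Reasoning n
        expand : ∀ E F x c c' M j j' s →
                 E * (F * x + c' + M * (j' * s)) + c + M * (j * (s + j')) ≡
                 E * F * x + (E * c' + c + M * (j * j')) + (E * M * (j' * s) + M * (j * s))
        expand = solve-∀
        collect : ∀ E x C M j j' s →
                  E * x + C + (M * (j' * s) + M * (j * s)) ≡ E * x + C + M * ((j + j') * s)
        collect = solve-∀

    R^[2+j] : ∀ j → R ^ (2 ℕ.+ j) ≈ - R ^ j [mod n ]
    R^[2+j] j = begin
      R * (R * R ^ j)  ≡⟨ *-assoc R R (R ^ j) ⟨
      R * R * R ^ j    ≈⟨ *-congʳ-mod (R ^ j) r²≈-1 ⟩
      - 1ℤ * R ^ j     ≡⟨ -1*i≡-i (R ^ j) ⟩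
      - R ^ j          ∎
      where open mod-Reasoning n

    R^[4q] : ∀ q → R ^ (q ℕ.* 4) ≈ 1ℤ [mod n ]
    R^[4q] zero    = mod-refl
    R^[4q] (suc q) = begin
      R ^ (2 ℕ.+ (2 ℕ.+ q ℕ.* 4)) ≈⟨ R^[2+j] (2 ℕ.+ q ℕ.* 4) ⟩
      - R ^ (2 ℕ.+ q ℕ.* 4)       ≈⟨ -‿cong-mod (R^[2+j] (q ℕ.* 4)) ⟩
      - - R ^ (q ℕ.* 4)           ≡⟨ neg-involutive (R ^ (q ℕ.* 4)) ⟩
      R ^ (q ℕ.* 4)               ≈⟨ R^[4q] q ⟩
      1ℤ                          ∎
      where open mod-Reasoning n

    R^-mod-4 : ∀ j → R ^ j ≈ R ^ (j ℕ.% 4) [mod n ]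
    R^-mod-4 j = begin
      R ^ j                                ≡⟨ cong (R ^_) (m≡m%n+[m/n]*n j 4) ⟩
      R ^ (j ℕ.% 4 ℕ.+ j ℕ./ 4 ℕ.* 4)      ≡⟨ ^-distribˡ-+-* R (j ℕ.% 4) (j ℕ./ 4 ℕ.* 4) ⟩
      R ^ (j ℕ.% 4) * R ^ (j ℕ./ 4 ℕ.* 4)  ≈⟨ *-congˡ-mod (R ^ (j ℕ.% 4)) (R^[4q] (j ℕ./ 4)) ⟩
      R ^ (j ℕ.% 4) * 1ℤ                   ≡⟨ *-identityʳ (R ^ (j ℕ.% 4)) ⟩
      R ^ (j ℕ.% 4)                        ∎
      where open mod-Reasoning n

    act-trivial : ∀ {j c} → + j ≈ 0ℤ [mod 2 ] → R ^ j ≈ 1ℤ [mod n ] → c ≈ 0ℤ [mod n ] →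
                  ∀ v → act j c v ≡ v
    act-trivial {j} {c} j≈0 Rʲ≈1 c≈0 v = trans (vertex-cong side-eq index-eq) (vertex-side-index v)
      where
      side-eq : side v + + j ≈ side v [mod 2 ]
      side-eq = mod-trans (+-congˡ-mod (side v) j≈0) (≡⇒mod (+-identityʳ (side v)))

      index-eq : R ^ j * index v + c + M * (+ j * side v) ≈ index v [mod n ]
      index-eq = begin
        R ^ j * index v + c + M * (+ j * side v)
          ≈⟨ +-cong-mod (+-cong-mod (*-congʳ-mod (index v) Rʲ≈1) c≈0)
                        (M*-cong (*-congʳ-mod (side v) j≈0)) ⟩
        1ℤ * index v + 0ℤ + M * (0ℤ * side v)
          ≡⟨ identity (index v) M (side v) ⟩
        index v ∎
        where
        open mod-Reasoning n
        identity : ∀ x M s → 1ℤ * x + 0ℤ + M * (0ℤ * s) ≡ x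
        identity = solve-∀

    act-index-step : ∀ j c (u v : Vertex n) k {t} → index v ≈ index u + k [mod n ] →
                     R ^ j * k + M * (+ j * (side v - side u)) ≈ t [mod n ] →
                     R ^ j * index v + c + M * (+ j * side v) ≈
                     R ^ j * index u + c + M * (+ j * side u) + t [mod n ]
    act-index-step j c u v k {t} v≈u+k tail≈t = begin
      R ^ j * index v + c + M * (+ j * side v)
        ≈⟨ +-congʳ-mod (M * (+ j * side v)) (+-congʳ-mod c (*-congˡ-mod (R ^ j) v≈u+k)) ⟩
      R ^ j * (index u + k) + c + M * (+ j * side v)
        ≡⟨ identity (R ^ j) (index u) k c M (+ j) (side u) (side v) ⟩
      R ^ j * index u + c + M * (+ j * side u) + (R ^ j * k + M * (+ j * (side v - side u)))
        ≈⟨ +-congˡ-mod (R ^ j * index u + c + M * (+ j * side u)) tail≈t ⟩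
      R ^ j * index u + c + M * (+ j * side u) + t ∎
      where
      open mod-Reasoning n
      identity : ∀ E x k c M j s s' →
                 E * (x + k) + c + M * (j * s') ≡
                 E * x + c + M * (j * s) + (E * k + M * (j * (s' - s)))
      identity = solve-∀

    translation-preserves : ∀ c → AdjacencyPreserving {n} {a} {r} (act 0 c)
    translation-preserves c = edge-preserving edge
      where
      tail : ∀ k s → 1ℤ * k + M * (+ 0 * s) ≈ k [mod n ]
      tail k s = ≡⇒mod (identity k M s)
        where identity : ∀ k M s → 1ℤ * k + M * (0ℤ * s) ≡ k
              identity = solve-∀

      edge : ∀ u v → Edge n a r u v → Adj n a r (act 0 c u) (act 0 c v)
      edge (A i)  (A i') e        = inj₁ (vertex-edge-AA mod-refl mod-refl
        (act-index-step 0 c (A i) (A i') 1ℤ (⊕⇒mod 1 e) (tail 1ℤ 0ℤ)))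
      edge (A i') (B i)  (inj₁ e) = inj₁ (vertex-edge-AB mod-refl mod-refl
        (inj₁ (act-index-step 0 c (B i) (A i') 0ℤ (≡⇒mod+0 e) (tail 0ℤ (- 1ℤ)))))
      edge (A i') (B i)  (inj₂ e) = inj₁ (vertex-edge-AB mod-refl mod-refl
        (inj₂ (act-index-step 0 c (B i) (A i') M (⊕⇒mod a e) (tail M (- 1ℤ)))))
      edge (B i)  (B i') e        = inj₁ (vertex-edge-BB mod-refl mod-refl
        (act-index-step 0 c (B i) (B i') R (⊕⇒mod r e) (tail R 0ℤ)))

    -- act 1 c swaps the sides: A–B edges come back reversed, and B–B edges become reversed A–A
    -- edges because r · r ≡ −1.
    rotation-preserves : ∀ c → AdjacencyPreserving {n} {a} {r} (act 1 c)
    rotation-preserves c = edge-preserving edge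
      where
      tail-AA : R ^ 1 * 1ℤ + M * (+ 1 * 0ℤ) ≈ R [mod n ]
      tail-AA = ≡⇒mod (identity R M)
        where identity : ∀ R M → R * 1ℤ * 1ℤ + M * (1ℤ * 0ℤ) ≡ R
              identity = solve-∀

      tail-AB₀ : R ^ 1 * - 0ℤ + M * (+ 1 * 1ℤ) ≈ M [mod n ]
      tail-AB₀ = ≡⇒mod (identity R M)
        where identity : ∀ R M → R * 1ℤ * - 0ℤ + M * (1ℤ * 1ℤ) ≡ M
              identity = solve-∀

      tail-AB₁ : R ^ 1 * - M + M * (+ 1 * 1ℤ) ≈ 0ℤ [mod n ]
      tail-AB₁ = begin
        R ^ 1 * - M + M * (+ 1 * 1ℤ) ≡⟨ identity (R ^ 1) M ⟩
        M - R ^ 1 * M                ≈⟨ +-congˡ-mod M (-‿cong-mod (R^*M 1)) ⟩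
        M - M                        ≡⟨ +-inverseʳ M ⟩
        0ℤ                           ∎
        where
        open mod-Reasoning n
        identity : ∀ E M → E * - M + M * (1ℤ * 1ℤ) ≡ M - E * M
        identity = solve-∀

      tail-BB : R ^ 1 * - R + M * (+ 1 * 0ℤ) ≈ 1ℤ [mod n ]
      tail-BB = begin
        R ^ 1 * - R + M * (+ 1 * 0ℤ) ≡⟨ identity R M ⟩
        - (R * R)                    ≈⟨ -‿cong-mod r²≈-1 ⟩
        1ℤ                           ∎
        where
        open mod-Reasoning n
        identity : ∀ R M → R * 1ℤ * - R + M * (1ℤ * 0ℤ) ≡ - (R * R)
        identity = solve-∀

      edge : ∀ u v → Edge n a r u v → Adj n a r (act 1 c u) (act 1 c v)
      edge (A i)  (A i') e        = inj₁ (vertex-edge-BB mod-refl mod-refl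
        (act-index-step 1 c (A i) (A i') 1ℤ (⊕⇒mod 1 e) tail-AA))
      edge (A i') (B i)  (inj₁ e) = inj₂ (vertex-edge-AB two≈0 mod-refl
        (inj₂ (act-index-step 1 c (A i') (B i) (- 0ℤ) (mod-flip 0ℤ (≡⇒mod+0 e)) tail-AB₀)))
      edge (A i') (B i)  (inj₂ e) = inj₂ (vertex-edge-AB two≈0 mod-refl
        (inj₁ (act-index-step 1 c (A i') (B i) (- M) (mod-flip M (⊕⇒mod a e)) tail-AB₁)))
      edge (B i)  (B i') e        = inj₂ (vertex-edge-AA two≈0 two≈0
        (act-index-step 1 c (B i') (B i) (- R) (mod-flip R (⊕⇒mod r e)) tail-BB))

    act-preserves : ∀ j c → AdjacencyPreserving {n} {a} {r} (act j c)
    act-preserves zero    c = translation-preserves c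
    act-preserves (suc j) c =
      ≗-preserving decompose (∘-preserving (rotation-preserves c') (act-preserves j 0ℤ))
      where
      c' : ℤ
      c' = c - M * (+ 1 * + j)

      decompose : ∀ v → act 1 c' (act j 0ℤ v) ≡ act (suc j) c v
      decompose v = trans (act-∘ 1 j c' 0ℤ v) (act-cong (suc j) (≡⇒mod (identity R c M (+ j))) v)
        where identity : ∀ R c M j → R * 1ℤ * 0ℤ + (c - M * (1ℤ * j)) + M * (1ℤ * j) ≡ c
              identity = solve-∀

    -- c ≡ (j choose 2) (mod 2), doubled so that it is additive under composition.
    Balanced : ℕ → ℤ → Set
    Balanced j c = + 2 * c ≈ + j * (+ j - 1ℤ) [mod 4 ]

    record Element : Set where
      constructor element
      field
        turns    : ℕ
        shift    : ℤ
        balanced : Balanced turns shift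

    actₑ : Element → Vertex n → Vertex n
    actₑ (element j c _) = act j c

    odd-factor : ∀ {x} y → x ≈ 1ℤ [mod 2 ] → x * y ≈ y [mod 2 ]
    odd-factor y x≈1 = mod-trans (*-congʳ-mod y x≈1) (≡⇒mod (*-identityˡ y))

    compose-balanced : ∀ {j j' c c'} → Balanced j c → Balanced j' c' →
                       Balanced (j ℕ.+ j') (compose-shift j j' c c')
    compose-balanced {j} {j'} {c} {c'} bal bal' = begin
      + 2 * (R ^ j * c' + c + M * (+ j * + j'))
        ≡⟨ distribute (R ^ j * c') c (M * (+ j * + j')) ⟩
      + 2 * (R ^ j * c') + + 2 * c + + 2 * (M * (+ j * + j'))
        ≈⟨ +-cong-mod (+-cong-mod (*-scale-mod 2 (odd-factor c' (R^-odd j))) bal)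
                      (*-scale-mod 2 (odd-factor (+ j * + j') a-odd)) ⟩
      + 2 * c' + + j * (+ j - 1ℤ) + + 2 * (+ j * + j')
        ≈⟨ +-congʳ-mod (+ 2 * (+ j * + j')) (+-congʳ-mod (+ j * (+ j - 1ℤ)) bal') ⟩
      + j' * (+ j' - 1ℤ) + + j * (+ j - 1ℤ) + + 2 * (+ j * + j')
        ≡⟨ square-of-sum (+ j) (+ j') ⟩
      (+ j + + j') * (+ j + + j' - 1ℤ)
        ≡⟨ cong (λ J → J * (J - 1ℤ)) (pos-+ j j') ⟨
      + (j ℕ.+ j') * (+ (j ℕ.+ j') - 1ℤ) ∎
      where
      open mod-Reasoning 4
      distribute : ∀ x y z → + 2 * (x + y + z) ≡ + 2 * x + + 2 * y + + 2 * z
      distribute = solve-∀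
      square-of-sum : ∀ j j' →
                      j' * (j' - 1ℤ) + j * (j - 1ℤ) + + 2 * (j * j') ≡ (j + j') * (j + j' - 1ℤ)
      square-of-sum = solve-∀

    act-full-turns : ∀ q {c} → c ≈ 0ℤ [mod n ] → ∀ v → act (q ℕ.* 4) c v ≡ v
    act-full-turns q = act-trivial (mod-intro (+ q * + 2) (begin
      + (q ℕ.* 4)          ≡⟨ pos-* q 4 ⟩
      + q * + 4            ≡⟨ identity (+ q) ⟩
      0ℤ + + q * + 2 * + 2 ∎)) (R^[4q] q)
      where
      open ≡-Reasoning
      identity : ∀ q → q * + 4 ≡ 0ℤ + q * + 2 * + 2
      identity = solve-∀

    inverse-shift : ℕ → ℤ → ℤ
    inverse-shift j c = - (R ^ (j ℕ.* 3) * c + M * (+ (j ℕ.* 3) * + j))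

    inverse-act : ∀ j c v → act (j ℕ.* 3) (inverse-shift j c) (act j c v) ≡ v
    inverse-act j c v = begin
      act (j ℕ.* 3) (inverse-shift j c) (act j c v)
        ≡⟨ act-∘ (j ℕ.* 3) j (inverse-shift j c) c v ⟩
      act (j ℕ.* 3 ℕ.+ j) (compose-shift (j ℕ.* 3) j (inverse-shift j c) c) v
        ≡⟨ cong (λ k → act k (compose-shift (j ℕ.* 3) j (inverse-shift j c) c) v) (three-plus-one j) ⟩
      act (j ℕ.* 4) (compose-shift (j ℕ.* 3) j (inverse-shift j c) c) v
        ≡⟨ act-full-turns j (≡⇒mod (cancel (R ^ (j ℕ.* 3) * c) (M * (+ (j ℕ.* 3) * + j)))) v ⟩
      v ∎
      where
      open ≡-Reasoning
      three-plus-one : ∀ j → j ℕ.* 3 ℕ.+ j ≡ j ℕ.* 4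
      three-plus-one = ℕ-Solver.solve-∀
      cancel : ∀ x y → x + - (x + y) + y ≡ 0ℤ
      cancel = solve-∀

    inverse-balanced : ∀ {j c} → Balanced j c → Balanced (j ℕ.* 3) (inverse-shift j c)
    inverse-balanced {j} {c} bal = begin
      + 2 * inverse-shift j c
        ≡⟨ distribute (R ^ (j ℕ.* 3) * c) (M * (+ (j ℕ.* 3) * + j)) ⟩
      - (+ 2 * (R ^ (j ℕ.* 3) * c)) - + 2 * (M * (+ (j ℕ.* 3) * + j))
        ≈⟨ +-cong-mod (-‿cong-mod (*-scale-mod 2 (odd-factor c (R^-odd (j ℕ.* 3)))))
                      (-‿cong-mod (*-scale-mod 2 (odd-factor (+ (j ℕ.* 3) * + j) a-odd))) ⟩
      - (+ 2 * c) - + 2 * (+ (j ℕ.* 3) * + j)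
        ≈⟨ +-congʳ-mod (- (+ 2 * (+ (j ℕ.* 3) * + j))) (-‿cong-mod bal) ⟩
      - (+ j * (+ j - 1ℤ)) - + 2 * (+ (j ℕ.* 3) * + j)
        ≡⟨ cong (λ J → - (+ j * (+ j - 1ℤ)) - + 2 * (J * + j)) (pos-* j 3) ⟩
      - (+ j * (+ j - 1ℤ)) - + 2 * (+ j * + 3 * + j)
        ≈⟨ mod-intro (+ j - + j * + j * + 4) (expand (+ j)) ⟩
      + j * + 3 * (+ j * + 3 - 1ℤ)
        ≡⟨ cong (λ J → J * (J - 1ℤ)) (pos-* j 3) ⟨
      + (j ℕ.* 3) * (+ (j ℕ.* 3) - 1ℤ) ∎
      where
      open mod-Reasoning 4
      distribute : ∀ x y → + 2 * - (x + y) ≡ - (+ 2 * x) - + 2 * y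
      distribute = solve-∀
      expand : ∀ j → - (j * (j - 1ℤ)) - + 2 * (j * + 3 * j) ≡
                     j * + 3 * (j * + 3 - 1ℤ) + (j - j * j * + 4) * + 4
      expand = solve-∀

    turns-even : ∀ {j c u} → act j c u ≡ u → + j ≈ 0ℤ [mod 2 ]
    turns-even {j} {c} {u} fix = begin
      + j                   ≡⟨ identity (side u) (+ j) ⟩
      side u + + j - side u ≈⟨ +-congʳ-mod (- side u) (mod-trans (mod-sym (side-act j c u))
                                                             (≡⇒mod (cong side fix))) ⟩
      side u - side u       ≡⟨ +-inverseʳ (side u) ⟩
      0ℤ                    ∎
      where
      open mod-Reasoning 2
      identity : ∀ s j → j ≡ s + j - s
      identity = solve-∀

    fixed-shift : ∀ {j c u} → act j c u ≡ u → c ≈ index u - R ^ j * index u [mod n ]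
    fixed-shift {j} {c} {u} fix = begin
      c
        ≡⟨ identity (R ^ j * index u) c (M * (+ j * side u)) ⟩
      R ^ j * index u + c + M * (+ j * side u) - R ^ j * index u - M * (+ j * side u)
        ≈⟨ +-cong-mod (+-congʳ-mod (- (R ^ j * index u)) fixed-index)
                      (-‿cong-mod (M*-cong (*-congʳ-mod (side u) (turns-even fix)))) ⟩
      index u - R ^ j * index u - M * (0ℤ * side u)
        ≡⟨ identity′ (index u) (R ^ j) M (side u) ⟩
      index u - R ^ j * index u ∎
      where
      open mod-Reasoning n
      fixed-index : R ^ j * index u + c + M * (+ j * side u) ≈ index u [mod n ]
      fixed-index = mod-trans (mod-sym (index-act j c u)) (≡⇒mod (cong index fix))
      identity : ∀ x c m → c ≡ x + c + m - x - m
      identity = solve-∀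
      identity′ : ∀ x E M s → x - E * x - M * (0ℤ * s) ≡ x - E * x
      identity′ = solve-∀

    -- A fixed point u forces j even and c ≡ index u − rʲ · index u.  For j ≡ 0 (mod 4) this gives
    -- c ≡ 0, the identity; for j ≡ 2 it gives c ≡ 2 · index u, which is even, against Balanced.
    free : ∀ j c → Balanced j c → ∀ u → act j c u ≡ u → ∀ v → act j c v ≡ v
    free j c bal u fix = by-residue (turns-even fix) (fixed-shift fix)
      where
      by-residue : + j ≈ 0ℤ [mod 2 ] → c ≈ index u - R ^ j * index u [mod n ] → ∀ v → act j c v ≡ v
      by-residue even shift with j ℕ.% 4 | m%n<n j 4 | mod-sym (%ℕ-mod {4} (+ j)) | R^-mod-4 j
      ... | 0 | _ | _ | Rʲ≈1 = act-trivial even Rʲ≈1 (begin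
        c                          ≈⟨ shift ⟩
        index u - R ^ j * index u  ≈⟨ +-congˡ-mod (index u) (-‿cong-mod (*-congʳ-mod (index u) Rʲ≈1)) ⟩
        index u - 1ℤ * index u     ≡⟨ identity (index u) ⟩
        0ℤ                         ∎)
        where
        open mod-Reasoning n
        identity : ∀ x → x - 1ℤ * x ≡ 0ℤ
        identity = solve-∀
      ... | 1 | _ | j≈1 | _ = contradiction (mod-trans (mod-sym (mod-divisor four≈0 j≈1)) even) 1≉0
      ... | 2 | _ | j≈2 | Rʲ≈R² =
        contradiction (mod-injective-below {4} {0} {2} ℕ.z<s (ℕ.s<s (ℕ.s<s ℕ.z<s)) 0≈2) λ ()
        where
        c-even : c ≈ 0ℤ [mod 2 ]
        c-even = begin
          c                           ≈⟨ mod-divisor (double≈0 a) shift ⟩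
          index u - R ^ j * index u   ≈⟨ +-congˡ-mod (index u) (-‿cong-mod (*-congʳ-mod (index u)
                                           (mod-divisor (double≈0 a) (mod-trans Rʲ≈R² (R^[2+j] 0))))) ⟩
          index u - - 1ℤ * index u    ≡⟨ identity (index u) ⟩
          0ℤ + index u * + 2          ≈⟨ mod-intro (index u) refl ⟩
          0ℤ                          ∎
          where
          open mod-Reasoning 2
          identity : ∀ x → x - - 1ℤ * x ≡ 0ℤ + x * + 2
          identity = solve-∀

        0≈2 : 0ℤ ≈ + 2 [mod 4 ]
        0≈2 = mod-trans (mod-sym (*-scale-mod 2 c-even))
                        (mod-trans bal (*-cong-mod j≈2 (+-congʳ-mod (- 1ℤ) j≈2)))
      ... | 3 | _ | j≈3 | _ =
        contradiction (mod-trans (mod-intro (- 1ℤ) refl) (mod-trans (mod-sym (mod-divisor four≈0 j≈3)) even))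
                      1≉0
      ... | suc (suc (suc (suc _))) | ℕ.s<s (ℕ.s<s (ℕ.s<s (ℕ.s<s ()))) | _ | _

    origin : Vertex n
    origin = vertex 0ℤ 0ℤ

    act-origin : ∀ j c → act j c origin ≡ vertex (+ j) c
    act-origin j c = vertex-cong (+-congʳ-mod (+ j) (side-vertex 0ℤ 0ℤ)) (begin
      R ^ j * index origin + c + M * (+ j * side origin)
        ≈⟨ +-cong-mod (+-congʳ-mod c (*-congˡ-mod (R ^ j) (index-vertex 0ℤ 0ℤ)))
                      (M*-cong (*-congˡ-mod (+ j) (side-vertex 0ℤ 0ℤ))) ⟩
      R ^ j * 0ℤ + c + M * (+ j * 0ℤ)
        ≡⟨ identity (R ^ j) c M (+ j) ⟩
      c ∎)
      where
      open mod-Reasoning n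
      identity : ∀ E c M j → E * 0ℤ + c + M * (j * 0ℤ) ≡ c
      identity = solve-∀

    act-origin-onto : ∀ j (v : Vertex n) → + j ≈ side v [mod 2 ] → act j (index v) origin ≡ v
    act-origin-onto j v j≈s =
      trans (act-origin j (index v)) (trans (vertex-cong j≈s mod-refl) (vertex-side-index v))

    -- j is chosen with j ≡ side v and (j choose 2) ≡ index v (mod 2).
    reach : ∀ v → ∃ λ γ → actₑ γ origin ≡ v
    reach v with parity (index v)
    reach (A i) | inj₁ even = element 0 (toℤ i) (*-scale-mod 2 even) , act-origin-onto 0 (A i) mod-refl
    reach (A i) | inj₂ odd  = element 2 (toℤ i) (*-scale-mod 2 odd) , act-origin-onto 2 (A i) two≈0
    reach (B i) | inj₁ even = element 1 (toℤ i) (*-scale-mod 2 even) , act-origin-onto 1 (B i) mod-refl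
    reach (B i) | inj₂ odd  =
      element 3 (toℤ i) (mod-trans (*-scale-mod 2 odd) (mod-intro (- 1ℤ) refl)) ,
      act-origin-onto 3 (B i) (mod-intro 1ℤ refl)

    _·_ : Element → Element → Element
    element j c bal · element j' c' bal' =
      element (j ℕ.+ j') (compose-shift j j' c c') (compose-balanced {j} {j'} {c} {c'} bal bal')

    inv : Element → Element
    inv (element j c bal) = element (j ℕ.* 3) (inverse-shift j c) (inverse-balanced {j} {c} bal)

    regularAction : RegularAction n a r
    regularAction = record
      { Element       = Element
      ; act           = actₑ
      ; act-preserves = λ { (element j c _) → act-preserves j c }
      ; unit          = element 0 0ℤ mod-refl
      ; _·_           = _·_
      ; inv           = inv
      ; unit-act      = act-full-turns 0 mod-refl
      ; ·-act         = λ { (element j c _) (element j' c' _) v → sym (act-∘ j j' c c' v) }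
      ; inv-act       = λ { (element j c _) → inverse-act j c }
      ; base          = origin
      ; reach         = reach
      ; free          = λ { (element j c bal) → free j c bal }
      }

    isCayley : IsCayleyRoseWindow n a r
    isCayley = regularSubgroup regularAction

open import Data.Nat using (_*_)

mainTheorem4 : (n a r : ℕ) → 3 ≤ n → 1 ≤ a → a ≤ n ∸ 1 → 1 ≤ r → r ≤ n ∸ 1 →
               (+ (r * r)) ≡ - (+ 1) [mod n ] →
               ((+ (r * a)) ≡ (+ a) [mod n ] ⊎ (+ (r * a)) ≡ - (+ a) [mod n ]) →
               IsCayleyRoseWindow n a r
mainTheorem4 (suc n) a r _ 1≤a a≤n _ _ r²≡-1 ra≡±a =
  subst (λ m → IsCayleyRoseWindow m a r) (sym n≡2a)
        (RoseWindowCayley.isCayley a r (subst (λ m → + r ℤ.* + r ≈ - 1ℤ [mod m ]) n≡2a r²≈-1))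
  where
  instance
    a-nonZero : NonZero a
    a-nonZero = ℕ.>-nonZero 1≤a

  congruent-product : ∀ {k x} → (+ (r * k)) ≡ x [mod suc n ] → + r ℤ.* + k ≈ x [mod suc n ]
  congruent-product {k} rk≡x = mod-trans (≡⇒mod (sym (pos-* r k))) (congruent rk≡x)

  r²≈-1 : + r ℤ.* + r ≈ - 1ℤ [mod suc n ]
  r²≈-1 = congruent-product r²≡-1

  n≡2a : suc n ≡ a * 2
  n≡2a = modulus-is-double {r = r} 1≤a (s≤s a≤n) r²≈-1
                            (Sum.map congruent-product congruent-product ra≡±a)
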